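{- If $T$ is a tree with $\operatorname{diam}(T)\geq 5$, then $\operatorname{con}(T\overline{T})=\max\{n(T),\,2\Delta(T)+1\}$.
   Context: For a graph $G$ with complement $\overline{G}$, the complementary prism $G\overline{G}$ is the graph obtained from the disjoint union of $G$ and $\overline{G}$ by adding the perfect matching joining each vertex $v$ of $G$ to its copy $\overline{v}$ in $\overline{G}$. For a graph $H$, a set $S\subseteq V(H)$ is (geodesically) convex if every vertex on every shortest path between two vertices of $S$ belongs to $S$. The convexity number $\operatorname{con}(H)$ is the maximum cardinality of a proper (i.e. $\neq V(H)$) convex set of $H$. $n(T)=|V(T)|$ and $\Delta(T)$ is the maximum degree of $T$. -}

module Defs where

open import Data.Nat using (ℕ; zero; suc; _≤_; _⊔_)
open import Data.Bool using (Bool; true; false; T; not; _∧_)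
open import Data.Fin using (Fin; splitAt)
open import Data.Fin.Properties using () renaming (_≟_ to _≟ᶠ_)
open import Data.Fin.Subset using (Subset; _∈_; _∉_; ∣_∣)
open import Data.Vec using (tabulate)
open import Data.List using (List; []; _∷_; foldr; allFin)
open import Data.List.Relation.Unary.Unique.Propositional using (Unique)
import Data.List.Membership.Propositional as LM
open import Data.Product using (Σ; ∃; _×_)
open import Data.Sum using (_⊎_; inj₁; inj₂)
open import Relation.Nullary using (¬_; does)
open import Relation.Binary.PropositionalEquality using (_≡_)

Graph : ℕ → Set
Graph n = Fin n → Fin n → Bool

IsSimple : ∀ {n} → Graph n → Set
IsSimple {n} G = (∀ (i j : Fin n) → G i j ≡ G j i) × (∀ (i : Fin n) → G i i ≡ false)

data Walk {n} (G : Graph n) : Fin n → Fin n → ℕ → Set where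
  here : ∀ {u} → Walk G u u 0
  step : ∀ {u w v k} → T (G u w) → Walk G w v k → Walk G u v (suc k)

verts : ∀ {n} {G : Graph n} {u v k} → Walk G u v k → List (Fin n)
verts {v = v} here = v ∷ []
verts {u = u} (step _ p) = u ∷ verts p

tail : ∀ {A : Set} → List A → List A
tail [] = []
tail (_ ∷ xs) = xs

Connected : ∀ {n} → Graph n → Set
Connected {n} G = ∀ (u v : Fin n) → ∃ λ k → Walk G u v k

-- a cycle: closed walk of length ≥ 3 whose vertices (first = last) are otherwise distinct
IsCycle : ∀ {n} {G : Graph n} {u k} → Walk G u u k → Set
IsCycle {k = k} p = (3 ≤ k) × Unique (tail (verts p))

Acyclic : ∀ {n} → Graph n → Set
Acyclic {n} G = ∀ (u : Fin n) (k : ℕ) (p : Walk G u u k) → ¬ IsCycle p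

IsTree : ∀ {n} → Graph n → Set
IsTree G = IsSimple G × Connected G × Acyclic G

Dist : ∀ {n} → Graph n → Fin n → Fin n → ℕ → Set
Dist G u v d = Walk G u v d × (∀ k → Walk G u v k → d ≤ k)

DiamAtLeast : ∀ {n} → Graph n → ℕ → Set
DiamAtLeast {n} G m = Σ (Fin n) λ u → Σ (Fin n) λ v → Σ ℕ λ d → Dist G u v d × (m ≤ d)

degree : ∀ {n} → Graph n → Fin n → ℕ
degree G i = ∣ tabulate (λ j → G i j) ∣

maxDegree : ∀ {n} → Graph n → ℕ
maxDegree {n} G = foldr (λ i m → degree G i ⊔ m) 0 (allFin n)

-- complementary prism on Fin (n + n): the first copy is G, the second the
-- complement of G, with the perfect matching v — v̄.
eqb : ∀ {n} → Fin n → Fin n → Bool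
eqb a b = does (a ≟ᶠ b)

prism : ∀ {n} → Graph n → Graph (n Data.Nat.+ n)
prism {n} G i j with splitAt n i | splitAt n j
... | inj₁ a | inj₁ b = G a b
... | inj₂ a | inj₂ b = not (G a b) ∧ not (eqb a b)
... | inj₁ a | inj₂ b = eqb a b
... | inj₂ a | inj₁ b = eqb a b

Convex : ∀ {m} → Graph m → Subset m → Set
Convex {m} H S = ∀ (u v : Fin m) (k : ℕ) (p : Walk H u v k) → u ∈ S → v ∈ S →
  (∀ k' → Walk H u v k' → k ≤ k') → ∀ x → x LM.∈ verts p → x ∈ S

Proper : ∀ {m} → Subset m → Set
Proper {m} S = ∃ λ (x : Fin m) → x ∉ S

IsConvexityNumber : ∀ {m} → Graph m → ℕ → Set
IsConvexityNumber {m} H c =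
  (∃ λ (S : Subset m) → Proper S × Convex H S × ∣ S ∣ ≡ c) ×
  (∀ (S : Subset m) → Proper S → Convex H S → ∣ S ∣ ≤ c)

module Submission where

-- Vertices of the prism are split into the copy of T ("left") and the copy
-- of its complement ("right"), so every subset is A ++ B with A, B ⊆ V(T).
--
-- Two proper convex sets are exhibited: the whole right copy
-- (n vertices), and the "star" N[u] ++ N(u) of size 2 deg(u) + 1 around a
-- vertex of maximum degree.  Both have diameter ≤ 2 in the prism, and a set of
-- diameter ≤ 2 is convex as soon as it contains the common neighbours of its
-- non-adjacent members; the checks are local and use that trees have no
-- 3- and 4-cycles (and, for the right copy, that diam(T) ≥ 5).
--
-- Let A ++ B be proper and convex; short geodesics through the
-- perfect matching force strong relations between A and B.  If some a ∈ A is
-- not in B, then B ⊆ N(a), and either B = ∅ (size ≤ n) or A ++ B lies in a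
-- star (size ≤ 2Δ + 1).  Otherwise A ⊆ B, and every a ∈ A has a neighbour
-- outside B (here diam(T) ≥ 5 and properness are used); choosing one gives an
-- injection A → V ∖ B, whence |A| + |B| ≤ n.

open import Defs
open import Data.Nat using (ℕ; zero; suc; _+_; _*_; _⊔_; _≤_; z≤n; s≤s)
open import Data.Nat.Properties
  using (module ≤-Reasoning; ≤-trans; ≤-reflexive; +-monoˡ-≤; *-monoʳ-≤; +-mono-≤; +-identityʳ; suc-injective; m≤m⊔n; m≤n⊔m; ⊔-sel; n≤0⇒n≡0; m≤o∸n⇒m+n≤o)
open import Data.Bool using (true; false; T; not; _∧_)
open import Data.Bool.Properties using (T-≡; T-∧)
open import Data.Fin using (Fin; zero; suc; splitAt; _↑ˡ_; _↑ʳ_)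
open import Data.Fin.Properties using (splitAt-↑ˡ; splitAt-↑ʳ; splitAt⁻¹-↑ˡ; splitAt⁻¹-↑ʳ; ↑ˡ-injective; ↑ʳ-injective; any?) renaming (_≟_ to _≟ᶠ_)
open import Data.Fin.Subset using (Subset; _∈_; _∉_; _⊆_; ∣_∣; ⁅_⁆; _∪_; _-_; ∁) renaming (⊥ to ∅; ⊤ to Full)
open import Data.Fin.Subset.Properties
  using (_∈?_; nonempty?; Empty-unique; ∣⊥∣≡0; ∣⊤∣≡n; ∉⊥; ∈⊤; ∣p∣≤n; p⊆q⇒∣p∣≤∣q∣; ∣⁅x⁆∣≡1; x∈⁅x⁆; x∈⁅y⁆⇒x≡y;
         x∈p∪q⁺; x∈p∪q⁻; ∪-identityˡ; p─⊥≡p; p─q⊆p; x∈p∧x≢y⇒x∈p-y; x∉p⇒x∈∁p; ∣∁p∣≡n∸∣p∣)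
open import Data.Vec using ([]; _∷_; here; there; tabulate; _++_) renaming (splitAt to splitAtᵛ)
open import Data.Vec.Properties using ([]=⇒lookup; lookup⇒[]=; lookup∘tabulate)
open import Data.List using (List; []; _∷_; foldr; allFin)
open import Data.List.Membership.Propositional using () renaming (_∈_ to _∈ˡ_)
open import Data.List.Membership.Propositional.Properties using (∈-allFin)
open import Data.List.Relation.Unary.Any using (here; there)
open import Data.List.Relation.Unary.All using ([]; _∷_)
open import Data.List.Relation.Unary.AllPairs using ([]; _∷_)
open import Data.Product using (Σ; ∃; _×_; _,_; proj₁; proj₂)
open import Data.Sum using (_⊎_; inj₁; inj₂)
open import Data.Empty using (⊥; ⊥-elim)
open import Data.Nat.Tactic.RingSolver using (solve-∀)
open import Data.Unit using (tt)
open import Function using (Equivalence)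
open import Relation.Nullary using (¬_; Dec; yes; no; ¬?; contradiction)
open import Relation.Nullary.Decidable using (T?; _×-dec_; _⊎-dec_; decidable-stable)
open import Relation.Binary.PropositionalEquality using (_≡_; _≢_; refl; sym; trans; cong; cong₂; subst)

T-not⁺ : ∀ {b} → ¬ T b → T (not b)
T-not⁺ {false} _ = tt
T-not⁺ {true} ¬t = ¬t tt

T-not⁻ : ∀ {b} → T (not b) → ¬ T b
T-not⁻ {false} _ ()

eqb⇒≡ : ∀ {n} {a b : Fin n} → T (eqb a b) → a ≡ b
eqb⇒≡ {a = a} {b} t with a ≟ᶠ b
... | yes a≡b = a≡b

eqb-refl : ∀ {n} (a : Fin n) → T (eqb a a)
eqb-refl a with a ≟ᶠ a
... | yes _ = tt
... | no a≢a = a≢a refl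

eqb-sym : ∀ {n} (a b : Fin n) → eqb a b ≡ eqb b a
eqb-sym a b with a ≟ᶠ b | b ≟ᶠ a
... | yes _ | yes _ = refl
... | no _ | no _ = refl
... | yes a≡b | no b≢a = contradiction (sym a≡b) b≢a
... | no a≢b | yes b≡a = contradiction (sym b≡a) a≢b

∈-++⁺ˡ : ∀ {m k} {A : Subset m} (B : Subset k) {a} → a ∈ A → a ↑ˡ k ∈ A ++ B
∈-++⁺ˡ B here = here
∈-++⁺ˡ B (there a∈A) = there (∈-++⁺ˡ B a∈A)

∈-++⁻ˡ : ∀ {m k} (A : Subset m) (B : Subset k) {a} → a ↑ˡ k ∈ A ++ B → a ∈ A
∈-++⁻ˡ (_ ∷ _) B {zero} here = here
∈-++⁻ˡ (_ ∷ A) B {suc _} (there a∈A++B) = there (∈-++⁻ˡ A B a∈A++B)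

∈-++⁺ʳ : ∀ {m k} (A : Subset m) {B : Subset k} {b} → b ∈ B → m ↑ʳ b ∈ A ++ B
∈-++⁺ʳ [] b∈B = b∈B
∈-++⁺ʳ (_ ∷ A) b∈B = there (∈-++⁺ʳ A b∈B)

∈-++⁻ʳ : ∀ {m k} (A : Subset m) (B : Subset k) {b} → m ↑ʳ b ∈ A ++ B → b ∈ B
∈-++⁻ʳ [] B b∈A++B = b∈A++B
∈-++⁻ʳ (_ ∷ A) B (there b∈A++B) = ∈-++⁻ʳ A B b∈A++B

∣++∣ : ∀ {m k} (A : Subset m) (B : Subset k) → ∣ A ++ B ∣ ≡ ∣ A ∣ + ∣ B ∣
∣++∣ [] B = refl
∣++∣ (true ∷ A) B = cong suc (∣++∣ A B)
∣++∣ (false ∷ A) B = ∣++∣ A B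

∣⁅x⁆∪p∣ : ∀ {n} {x : Fin n} {p : Subset n} → x ∉ p → ∣ ⁅ x ⁆ ∪ p ∣ ≡ suc ∣ p ∣
∣⁅x⁆∪p∣ {x = zero} {true ∷ p} x∉p = contradiction here x∉p
∣⁅x⁆∪p∣ {x = zero} {false ∷ p} _ = cong (λ q → suc ∣ q ∣) (∪-identityˡ p)
∣⁅x⁆∪p∣ {x = suc x} {true ∷ p} x∉p = cong suc (∣⁅x⁆∪p∣ (λ x∈p → x∉p (there x∈p)))
∣⁅x⁆∪p∣ {x = suc x} {false ∷ p} x∉p = ∣⁅x⁆∪p∣ (λ x∈p → x∉p (there x∈p))

∣p∣≡1+∣p-x∣ : ∀ {n} {x : Fin n} {p : Subset n} → x ∈ p → ∣ p ∣ ≡ suc ∣ p - x ∣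
∣p∣≡1+∣p-x∣ {p = true ∷ p} here = cong (λ q → suc ∣ q ∣) (sym (p─⊥≡p p))
∣p∣≡1+∣p-x∣ {p = true ∷ _} (there x∈p) = cong suc (∣p∣≡1+∣p-x∣ x∈p)
∣p∣≡1+∣p-x∣ {p = false ∷ _} (there x∈p) = ∣p∣≡1+∣p-x∣ x∈p

x∉p-x : ∀ {n} {x : Fin n} (p : Subset n) → x ∉ p - x
x∉p-x {x = zero} (_ ∷ _) ()
x∉p-x {x = suc _} (_ ∷ p) (there x∈p-x) = x∉p-x p x∈p-x

-- Pigeonhole for subsets: a map sending P injectively into Q shows |P| ≤ |Q|.
-- Stated for k = |P| to induct on k: remove a point of P and its image in Q.
injection⇒∣p∣≤∣q∣ : ∀ {n} k (P Q : Subset n) (f : Fin n → Fin n) → ∣ P ∣ ≡ k →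
  (∀ {x} → x ∈ P → f x ∈ Q) → (∀ {x y} → x ∈ P → y ∈ P → f x ≡ f y → x ≡ y) → k ≤ ∣ Q ∣
injection⇒∣p∣≤∣q∣ zero P Q f _ _ _ = z≤n
injection⇒∣p∣≤∣q∣ {n} (suc k) P Q f ∣P∣≡1+k into inj with nonempty? P
... | no empty = contradiction (trans (sym ∣P∣≡1+k) (trans (cong ∣_∣ (Empty-unique empty)) (∣⊥∣≡0 n))) λ ()
... | yes (x , x∈P) =
  subst (suc k ≤_) (sym (∣p∣≡1+∣p-x∣ (into x∈P))) (s≤s (injection⇒∣p∣≤∣q∣ k (P - x) (Q - f x) f ∣P-x∣≡k into′ inj′))
  where
  ∣P-x∣≡k : ∣ P - x ∣ ≡ k
  ∣P-x∣≡k = suc-injective (trans (sym (∣p∣≡1+∣p-x∣ x∈P)) ∣P∣≡1+k)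
  inj′ : ∀ {y z} → y ∈ P - x → z ∈ P - x → f y ≡ f z → y ≡ z
  inj′ y∈ z∈ = inj (p─q⊆p P _ y∈) (p─q⊆p P _ z∈)
  into′ : ∀ {y} → y ∈ P - x → f y ∈ Q - f x
  into′ {y} y∈ = x∈p∧x≢y⇒x∈p-y (into (p─q⊆p P _ y∈)) fy≢fx
    where
    fy≢fx : f y ≢ f x
    fy≢fx fy≡fx = x∉p-x P (subst (_∈ P - x) (inj (p─q⊆p P _ y∈) x∈P fy≡fx) y∈)

module _ {m : ℕ} {G : Graph m} where

  _++ʷ_ : ∀ {u v w k l} → Walk G u v k → Walk G v w l → Walk G u w (k + l)
  here ++ʷ q = q
  step e p ++ʷ q = step e (p ++ʷ q)

  snocʷ : ∀ {u v w k} → Walk G u v k → T (G v w) → Walk G u w (suc k)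
  snocʷ here e = step e here
  snocʷ (step e′ p) e = step e′ (snocʷ p e)

  lastEdge : ∀ {u v k} → Walk G u v (suc k) → ∃ λ w → T (G w v)
  lastEdge (step {u = u} e here) = u , e
  lastEdge (step _ (step e p)) = lastEdge (step e p)

  firstEdge : ∀ {u v k} → Walk G u v k → u ≢ v → ∃ λ w → T (G u w)
  firstEdge here u≢u = contradiction refl u≢u
  firstEdge (step {w = w} e _) _ = w , e

Within : ∀ {m} → Graph m → ℕ → Fin m → Fin m → Set
Within G d u v = Σ ℕ λ k → k ≤ d × Walk G u v k

module _ {m : ℕ} {G : Graph m} where

  within-refl : ∀ {u} → Within G 0 u u
  within-refl = 0 , z≤n , here

  within-edge : ∀ {u v} → T (G u v) → Within G 1 u v
  within-edge e = 1 , s≤s z≤n , step e here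

  within-trans : ∀ {u v w d e} → Within G d u v → Within G e v w → Within G (d + e) u w
  within-trans (k , k≤d , p) (l , l≤e , q) = k + l , +-mono-≤ k≤d l≤e , p ++ʷ q

  within-weaken : ∀ {u v d e} → d ≤ e → Within G d u v → Within G e u v
  within-weaken d≤e (k , k≤d , p) = k , ≤-trans k≤d d≤e , p

  module _ (symmetric : ∀ i j → G i j ≡ G j i) where

    reverseʷ : ∀ {u v k} → Walk G u v k → Walk G v u k
    reverseʷ here = here
    reverseʷ (step {u = u} {w = w} e p) = snocʷ (reverseʷ p) (subst T (symmetric u w) e)

    within-sym : ∀ {u v d} → Within G d u v → Within G d v u
    within-sym (k , k≤d , p) = k , k≤d , reverseʷ p

MidpointClosed : ∀ {m} → Graph m → Subset m → Set
MidpointClosed H S = ∀ {x y w} → x ∈ S → y ∈ S → x ≢ y → ¬ T (H x y) → T (H x w) → T (H w y) → w ∈ S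

module _ {m : ℕ} (H : Graph m) (S : Subset m) where

  -- If x ≠ y are non-adjacent, x w y is a shortest x–y walk; so convex sets
  -- are midpoint closed.
  convex⇒midpointClosed : Convex H S → MidpointClosed H S
  convex⇒midpointClosed convex {x} {y} {w} x∈S y∈S x≢y x≁y xw wy =
    convex x y 2 (step xw (step wy here)) x∈S y∈S atLeastTwo w (there (here refl))
    where
    atLeastTwo : ∀ k → Walk H x y k → 2 ≤ k
    atLeastTwo .0 here = contradiction refl x≢y
    atLeastTwo .1 (step xy here) = contradiction xy x≁y
    atLeastTwo _ (step _ (step _ _)) = s≤s (s≤s z≤n)

  -- Conversely, if any two members of S are at distance ≤ 2, every shortest walk
  -- between them has length ≤ 2, and its only inner vertex is such a midpoint.
  midpointClosed⇒convex : (∀ {x y} → x ∈ S → y ∈ S → Within H 2 x y) → MidpointClosed H S → Convex H S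
  midpointClosed⇒convex near closed u v _ p u∈S v∈S shortest z z∈p = onWalk p shortest z∈p
    where
    atMostTwo : ∀ {k} → (∀ k′ → Walk H u v k′ → k ≤ k′) → k ≤ 2
    atMostTwo shortest′ with near u∈S v∈S
    ... | (k′ , k′≤2 , q) = ≤-trans (shortest′ k′ q) k′≤2
    onWalk : ∀ {k} (p : Walk H u v k) → (∀ k′ → Walk H u v k′ → k ≤ k′) → z ∈ˡ verts p → z ∈ S
    onWalk here _ (here refl) = v∈S
    onWalk (step _ here) _ (here refl) = u∈S
    onWalk (step _ here) _ (there (here refl)) = v∈S
    onWalk (step _ (step _ here)) _ (here refl) = u∈S
    onWalk (step _ (step _ here)) _ (there (there (here refl))) = v∈S
    onWalk (step uw (step wv here)) shortest′ (there (here refl)) = closed u∈S v∈S u≢v u≁v uw wv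
      where
      u≢v : u ≢ v
      u≢v refl with shortest′ 0 here
      ... | ()
      u≁v : ¬ T (H u v)
      u≁v uv with shortest′ 1 (step uv here)
      ... | s≤s ()
    onWalk (step _ (step _ (step _ _))) shortest′ _ with atMostTwo shortest′
    ... | s≤s (s≤s ())

module Neighbourhood {n : ℕ} (G : Graph n) where

  N : Fin n → Subset n
  N a = tabulate (G a)

  N[_] : Fin n → Subset n
  N[ a ] = ⁅ a ⁆ ∪ N a

  ∈N⁺ : ∀ {a x} → T (G a x) → x ∈ N a
  ∈N⁺ {a} {x} ax = lookup⇒[]= x (N a) (trans (lookup∘tabulate (G a) x) (Equivalence.to T-≡ ax))

  ∈N⁻ : ∀ {a x} → x ∈ N a → T (G a x)
  ∈N⁻ {a} {x} x∈ = Equivalence.from T-≡ (trans (sym (lookup∘tabulate (G a) x)) ([]=⇒lookup x∈))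

  ∈N[]⁺ : ∀ {a x} → x ≡ a ⊎ T (G a x) → x ∈ N[ a ]
  ∈N[]⁺ {a} (inj₁ refl) = x∈p∪q⁺ (inj₁ (x∈⁅x⁆ a))
  ∈N[]⁺ (inj₂ ax) = x∈p∪q⁺ (inj₂ (∈N⁺ ax))

  ∈N[]⁻ : ∀ {a x} → x ∈ N[ a ] → x ≡ a ⊎ T (G a x)
  ∈N[]⁻ {a} x∈ with x∈p∪q⁻ ⁅ a ⁆ (N a) x∈
  ... | inj₁ x∈⁅a⁆ = inj₁ (x∈⁅y⁆⇒x≡y a x∈⁅a⁆)
  ... | inj₂ x∈Na = inj₂ (∈N⁻ x∈Na)

  ∣N[]∣ : ∀ {a} → ¬ T (G a a) → ∣ N[ a ] ∣ ≡ suc (degree G a)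
  ∣N[]∣ a≁a = ∣⁅x⁆∪p∣ (λ a∈Na → a≁a (∈N⁻ a∈Na))

  private
    maxOf : List (Fin n) → ℕ
    maxOf = foldr (λ i m → degree G i ⊔ m) 0

    degree≤maxOf : ∀ {i} xs → i ∈ˡ xs → degree G i ≤ maxOf xs
    degree≤maxOf (x ∷ xs) (here refl) = m≤m⊔n (degree G x) _
    degree≤maxOf (x ∷ xs) (there i∈xs) = ≤-trans (degree≤maxOf xs i∈xs) (m≤n⊔m (degree G x) _)

    maxOf-attained : ∀ xs → maxOf xs ≡ 0 ⊎ ∃ λ i → degree G i ≡ maxOf xs
    maxOf-attained [] = inj₁ refl
    maxOf-attained (x ∷ xs) with ⊔-sel (degree G x) (maxOf xs)
    ... | inj₁ eq = inj₂ (x , sym eq)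
    ... | inj₂ eq with maxOf-attained xs
    ...   | inj₁ max≡0 = inj₁ (trans eq max≡0)
    ...   | inj₂ (i , attained) = inj₂ (i , trans attained (sym eq))

  degree≤maxDegree : ∀ i → degree G i ≤ maxDegree G
  degree≤maxDegree i = degree≤maxOf (allFin n) (∈-allFin i)

  maxDegree-attained : Fin n → ∃ λ c → degree G c ≡ maxDegree G
  maxDegree-attained v with maxOf-attained (allFin n)
  ... | inj₂ attained = attained
  ... | inj₁ max≡0 = v , trans (n≤0⇒n≡0 (subst (degree G v ≤_) max≡0 (degree≤maxDegree v))) (sym max≡0)

module Prism {n : ℕ} (G : Graph n) where

  H : Graph (n + n)
  H = prism G

  left right : Fin n → Fin (n + n)
  left a = a ↑ˡ n
  right b = n ↑ʳ b

  data Copy : Fin (n + n) → Set where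
    inLeft : ∀ a → Copy (left a)
    inRight : ∀ b → Copy (right b)

  copy : ∀ i → Copy i
  copy i with splitAt n i in eq
  ... | inj₁ a = subst Copy (splitAt⁻¹-↑ˡ eq) (inLeft a)
  ... | inj₂ b = subst Copy (splitAt⁻¹-↑ʳ eq) (inRight b)

  left-injective : ∀ {a b} → left a ≡ left b → a ≡ b
  left-injective {a} {b} = ↑ˡ-injective n a b

  right-injective : ∀ {a b} → right a ≡ right b → a ≡ b
  right-injective {a} {b} = ↑ʳ-injective n a b

  left≢right : ∀ {a b} → left a ≢ right b
  left≢right {a} {b} eq with trans (sym (splitAt-↑ˡ n a n)) (trans (cong (splitAt n) eq) (splitAt-↑ʳ n n b))
  ... | ()

  H-ll : ∀ a b → H (left a) (left b) ≡ G a b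
  H-ll a b rewrite splitAt-↑ˡ n a n | splitAt-↑ˡ n b n = refl

  H-lr : ∀ a b → H (left a) (right b) ≡ eqb a b
  H-lr a b rewrite splitAt-↑ˡ n a n | splitAt-↑ʳ n n b = refl

  H-rl : ∀ a b → H (right a) (left b) ≡ eqb a b
  H-rl a b rewrite splitAt-↑ʳ n n a | splitAt-↑ˡ n b n = refl

  H-rr : ∀ a b → H (right a) (right b) ≡ not (G a b) ∧ not (eqb a b)
  H-rr a b rewrite splitAt-↑ʳ n n a | splitAt-↑ʳ n n b = refl

  edgeˡ⁺ : ∀ {a b} → T (G a b) → T (H (left a) (left b))
  edgeˡ⁺ {a} {b} = subst T (sym (H-ll a b))

  edgeˡ⁻ : ∀ {a b} → T (H (left a) (left b)) → T (G a b)
  edgeˡ⁻ {a} {b} = subst T (H-ll a b)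

  rung : ∀ a → T (H (left a) (right a))
  rung a = subst T (sym (H-lr a a)) (eqb-refl a)

  rungˡ⁻ : ∀ {a b} → T (H (left a) (right b)) → a ≡ b
  rungˡ⁻ {a} {b} t = eqb⇒≡ (subst T (H-lr a b) t)

  rungʳ⁻ : ∀ {a b} → T (H (right a) (left b)) → a ≡ b
  rungʳ⁻ {a} {b} t = eqb⇒≡ (subst T (H-rl a b) t)

  edgeʳ⁺ : ∀ {a b} → ¬ T (G a b) → a ≢ b → T (H (right a) (right b))
  edgeʳ⁺ {a} {b} a≁b a≢b =
    subst T (sym (H-rr a b)) (Equivalence.from T-∧ (T-not⁺ a≁b , T-not⁺ (λ t → a≢b (eqb⇒≡ t))))

  edgeʳ⁻ : ∀ {a b} → T (H (right a) (right b)) → ¬ T (G a b)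
  edgeʳ⁻ {a} {b} t = T-not⁻ (proj₁ (Equivalence.to T-∧ (subst T (H-rr a b) t)))

  left-right-near : ∀ x y → Within H 2 (left x) (right y)
  left-right-near x y with T? (G x y) | x ≟ᶠ y
  ... | yes xy | _ = within-trans (within-edge (edgeˡ⁺ xy)) (within-edge (rung y))
  ... | no _ | yes refl = within-weaken (s≤s z≤n) (within-edge (rung x))
  ... | no x≁y | no x≢y = within-trans (within-edge (rung x)) (within-edge (edgeʳ⁺ x≁y x≢y))

  H-symmetric : (∀ a b → G a b ≡ G b a) → ∀ i j → H i j ≡ H j i
  H-symmetric sym-G i j with copy i | copy j
  ... | inLeft a | inLeft b = trans (H-ll a b) (trans (sym-G a b) (sym (H-ll b a)))
  ... | inLeft a | inRight b = trans (H-lr a b) (trans (eqb-sym a b) (sym (H-rl b a)))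
  ... | inRight a | inLeft b = trans (H-rl a b) (trans (eqb-sym a b) (sym (H-lr b a)))
  ... | inRight a | inRight b =
    trans (H-rr a b) (trans (cong₂ (λ p q → not p ∧ not q) (sym-G a b) (eqb-sym a b)) (sym (H-rr b a)))

module Tree {n : ℕ} (G : Graph n) (tree : IsTree G) where
  open Prism G using (right; edgeʳ⁺)

  symmetric : ∀ i j → G i j ≡ G j i
  symmetric = proj₁ (proj₁ tree)

  flip : ∀ {u v} → T (G u v) → T (G v u)
  flip {u} {v} = subst T (symmetric u v)

  irreflexive : ∀ i → ¬ T (G i i)
  irreflexive i t = subst T (proj₂ (proj₁ tree) i) t

  adjacent⇒≢ : ∀ {a b} → T (G a b) → a ≢ b
  adjacent⇒≢ {a} ab refl = irreflexive a ab

  no-triangle : ∀ {a b c} → T (G a b) → T (G b c) → T (G c a) → ⊥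
  no-triangle {a} ab bc ca =
    proj₂ (proj₂ tree) a 3 (step ab (step bc (step ca here)))
      (s≤s (s≤s (s≤s z≤n)) ,
       ((adjacent⇒≢ bc ∷ (λ b≡a → adjacent⇒≢ ab (sym b≡a)) ∷ []) ∷ (adjacent⇒≢ ca ∷ []) ∷ [] ∷ []))

  no-square : ∀ {a b c d} → a ≢ c → b ≢ d → T (G a b) → T (G b c) → T (G c d) → T (G d a) → ⊥
  no-square {a} a≢c b≢d ab bc cd da =
    proj₂ (proj₂ tree) a 4 (step ab (step bc (step cd (step da here))))
      (s≤s (s≤s (s≤s z≤n)) ,
       ((adjacent⇒≢ bc ∷ b≢d ∷ (λ b≡a → adjacent⇒≢ ab (sym b≡a)) ∷ []) ∷
        (adjacent⇒≢ cd ∷ (λ c≡a → a≢c (sym c≡a)) ∷ []) ∷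
        (adjacent⇒≢ da ∷ []) ∷ [] ∷ []))

  neighbours-nonadjacent : ∀ {u x y} → T (G u x) → T (G u y) → ¬ T (G x y)
  neighbours-nonadjacent ux uy xy = no-triangle ux xy (flip uy)

  connected : Connected G
  connected = proj₁ (proj₂ tree)

  hasNeighbour : ∀ {a b} → a ≢ b → ∃ λ c → T (G a c)
  hasNeighbour {a} {b} = firstEdge (proj₂ (connected a b))

  Close : Fin n → Fin n → Fin n → Set
  Close u v x = x ≡ u ⊎ x ≡ v ⊎ T (G u x) ⊎ T (G v x)

  close? : ∀ u v x → Dec (Close u v x)
  close? u v x = (x ≟ᶠ u) ⊎-dec ((x ≟ᶠ v) ⊎-dec (T? (G u x) ⊎-dec T? (G v x)))

  close⇒within2 : ∀ {u v x} → T (G u v) → Close u v x → Within G 2 x v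
  close⇒within2 uv (inj₁ refl) = within-weaken (s≤s z≤n) (within-edge uv)
  close⇒within2 uv (inj₂ (inj₁ refl)) = within-weaken z≤n within-refl
  close⇒within2 uv (inj₂ (inj₂ (inj₁ ux))) = within-trans (within-edge (flip ux)) (within-edge uv)
  close⇒within2 uv (inj₂ (inj₂ (inj₂ vx))) = within-weaken (s≤s z≤n) (within-edge (flip vx))

  far⇒complementMidpoint : ∀ {u v w} → ¬ Close u v w →
    T (prism G (right u) (right w)) × T (prism G (right w) (right v))
  far⇒complementMidpoint far-w =
    edgeʳ⁺ (λ uw → far-w (inj₂ (inj₂ (inj₁ uw)))) (λ u≡w → far-w (inj₁ (sym u≡w))) ,
    edgeʳ⁺ (λ wv → far-w (inj₂ (inj₂ (inj₂ (flip wv))))) (λ w≡v → far-w (inj₂ (inj₁ w≡v)))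

  -- The first and last edges of a shortest path of length ≥ 5: their outer
  -- ends are at distance > 4.  This is how diam(T) ≥ 5 enters the proof.
  record LongPath : Set where
    field
      start next prev end : Fin n
      start-edge : T (G start next)
      end-edge : T (G prev end)
      far : ¬ Within G 4 start end

  longPath : DiamAtLeast G 5 → LongPath
  longPath (a , b , _ , (p , shortest) , 5≤d) = endEdges p shortest 5≤d
    where
    endEdges : ∀ {d} → Walk G a b d → (∀ k → Walk G a b k → d ≤ k) → 5 ≤ d → LongPath
    endEdges (step {w = w} e q) shortest′ 5≤d′ with lastEdge (step e q)
    ... | (w′ , e′) = record
      { start = a ; next = w ; prev = w′ ; end = b ; start-edge = e ; end-edge = e′ ; far = tooShort }
      where
      tooShort : ¬ Within G 4 a b
      tooShort (k , k≤4 , r) with ≤-trans 5≤d′ (≤-trans (shortest′ k r) k≤4)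
      ... | s≤s (s≤s (s≤s (s≤s ())))

  module _ (path : LongPath) where
    open LongPath path

    -- Every vertex has a neighbour (T has the two distinct vertices start, end).
    neighbour : ∀ a → ∃ λ b → T (G a b)
    neighbour a with a ≟ᶠ start
    ... | no a≢start = hasNeighbour a≢start
    ... | yes refl = hasNeighbour start≢end
      where
      start≢end : start ≢ end
      start≢end start≡end = far (subst (Within G 4 start) start≡end (within-weaken z≤n within-refl))

    -- No edge is close to every vertex: otherwise d(start, end) ≤ 2 + 2.
    farFromEdge : ∀ {u v} → T (G u v) → ∃ λ w → ¬ Close u v w
    farFromEdge {u} {v} uv with close? u v start | close? u v end
    ... | no start-far | _ = start , start-far
    ... | yes _ | no end-far = end , end-far
    ... | yes start-close | yes end-close =
      contradiction (within-trans (close⇒within2 uv start-close) (within-sym symmetric (close⇒within2 uv end-close))) far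

ConvexWitness : ∀ {m} → Graph m → ℕ → Set
ConvexWitness {m} H c = ∃ λ (S : Subset m) → Proper S × Convex H S × ∣ S ∣ ≡ c

-- a star around a vertex of degree d has (d + 1) + d vertices; with d ≤ Δ
-- this is at most 2Δ + 1
starSize : ∀ d → suc d + d ≡ 2 * d + 1
starSize = solve-∀

starSize-mono : ∀ {d D} → d ≤ D → suc d + d ≤ 2 * D + 1
starSize-mono {d} {D} d≤D = ≤-trans (≤-reflexive (starSize d)) (+-monoˡ-≤ 1 (*-monoʳ-≤ 2 d≤D))

-- Both lower-bound sets have diameter ≤ 2 in the prism and are midpoint closed.
module LowerBound {n : ℕ} (G : Graph n) (tree : IsTree G) where
  open Tree G tree
  open Prism G
  open Neighbourhood G

  H-sym : ∀ i j → H i j ≡ H j i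
  H-sym = H-symmetric symmetric

  H-flip : ∀ {i j} → T (H i j) → T (H j i)
  H-flip {i} {j} = subst T (H-sym i j)

  -- The right copy: two complement vertices are adjacent, or, if adjacent in T,
  -- joined through a vertex far from their edge; a left vertex is adjacent to
  -- only one of them.
  module RightCopy (path : LongPath) where
    rightCopy : Subset (n + n)
    rightCopy = ∅ {n} ++ Full {n}

    left∉rightCopy : ∀ {a} → left a ∉ rightCopy
    left∉rightCopy a∈ = ∉⊥ (∈-++⁻ˡ (∅ {n}) Full a∈)

    right∈rightCopy : ∀ {b} → right b ∈ rightCopy
    right∈rightCopy = ∈-++⁺ʳ (∅ {n}) ∈⊤

    rightCopy-near : ∀ {i j} → i ∈ rightCopy → j ∈ rightCopy → Within H 2 i j
    rightCopy-near {i} {j} i∈ j∈ with copy i | copy j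
    ... | inLeft _ | _ = contradiction i∈ left∉rightCopy
    ... | inRight _ | inLeft _ = contradiction j∈ left∉rightCopy
    ... | inRight a | inRight b with a ≟ᶠ b | T? (G a b)
    ...   | yes refl | _ = within-weaken z≤n within-refl
    ...   | no a≢b | no a≁b = within-weaken (s≤s z≤n) (within-edge (edgeʳ⁺ a≁b a≢b))
    ...   | no _ | yes ab with farFromEdge path ab
    ...     | w , far-w with far⇒complementMidpoint far-w
    ...       | aw , wb = within-trans (within-edge aw) (within-edge wb)

    rightCopy-midpoints : MidpointClosed H rightCopy
    rightCopy-midpoints {i} {j} {w} i∈ j∈ i≢j _ iw wj with copy i | copy j | copy w
    ... | _ | _ | inRight _ = right∈rightCopy
    ... | inLeft _ | _ | _ = contradiction i∈ left∉rightCopy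
    ... | _ | inLeft _ | _ = contradiction j∈ left∉rightCopy
    ... | inRight a | inRight b | inLeft c = contradiction (cong right (trans (rungʳ⁻ iw) (rungˡ⁻ wj))) i≢j

    rightCopyWitness : ConvexWitness H n
    rightCopyWitness =
      rightCopy , (left (LongPath.start path) , left∉rightCopy) ,
      midpointClosed⇒convex H rightCopy rightCopy-near rightCopy-midpoints ,
      trans (∣++∣ (∅ {n}) (Full {n})) (cong₂ _+_ (∣⊥∣≡0 n) (∣⊤∣≡n n))

  -- The star N[u] ++ N(u): every member is within distance 2 of every other
  -- (through u, a rung, or a complement edge), and a common neighbour outside
  -- the star would close a 3- or 4-cycle through u.
  module Star (u : Fin n) where
    star : Subset (n + n)
    star = N[ u ] ++ N u

    left∈star⁺ : ∀ {x} → x ≡ u ⊎ T (G u x) → left x ∈ star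
    left∈star⁺ x∈ = ∈-++⁺ˡ (N u) (∈N[]⁺ x∈)

    left∈star⁻ : ∀ {x} → left x ∈ star → x ≡ u ⊎ T (G u x)
    left∈star⁻ x∈ = ∈N[]⁻ (∈-++⁻ˡ N[ u ] (N u) x∈)

    right∈star⁺ : ∀ {y} → T (G u y) → right y ∈ star
    right∈star⁺ uy = ∈-++⁺ʳ N[ u ] (∈N⁺ uy)

    right∈star⁻ : ∀ {y} → right y ∈ star → T (G u y)
    right∈star⁻ y∈ = ∈N⁻ (∈-++⁻ʳ N[ u ] (N u) y∈)

    toCentre : ∀ {x} → x ≡ u ⊎ T (G u x) → Within H 1 (left x) (left u)
    toCentre (inj₁ refl) = within-weaken z≤n within-refl
    toCentre (inj₂ ux) = within-edge (edgeˡ⁺ (flip ux))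

    star-near : ∀ {i j} → i ∈ star → j ∈ star → Within H 2 i j
    star-near {i} {j} i∈ j∈ with copy i | copy j
    ... | inLeft x | inLeft y = within-trans (toCentre (left∈star⁻ i∈)) (within-sym H-sym (toCentre (left∈star⁻ j∈)))
    ... | inLeft x | inRight y = left-right-near x y
    ... | inRight x | inLeft y = within-sym H-sym (left-right-near y x)
    ... | inRight x | inRight y with x ≟ᶠ y
    ...   | yes refl = within-weaken z≤n within-refl
    ...   | no x≢y = within-weaken (s≤s z≤n)
                       (within-edge (edgeʳ⁺ (neighbours-nonadjacent (right∈star⁻ i∈) (right∈star⁻ j∈)) x≢y))

    crossMidpoint : ∀ {x y w} → x ≡ u ⊎ T (G u x) → T (G u y) → T (H (left x) w) → T (H w (right y)) → w ∈ star
    crossMidpoint {x} {y} {w} x∈ uy xw wy with copy w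
    ... | inLeft c = left∈star⁺ (inj₂ (subst (λ z → T (G u z)) (sym (rungˡ⁻ wy)) uy))
    ... | inRight c with rungˡ⁻ xw | x∈
    ...   | refl | inj₂ ux = right∈star⁺ ux
    ...   | refl | inj₁ refl = contradiction uy (edgeʳ⁻ wy)

    leftMidpoint : ∀ {x y w} → x ≡ u ⊎ T (G u x) → y ≡ u ⊎ T (G u y) → x ≢ y →
                   T (H (left x) w) → T (H w (left y)) → w ∈ star
    leftMidpoint {x} {y} {w} x∈ y∈ x≢y xw wy with copy w
    ... | inRight c = contradiction (trans (rungˡ⁻ xw) (rungʳ⁻ wy)) x≢y
    ... | inLeft c with x∈ | y∈ | c ≟ᶠ u
    ...   | inj₁ refl | _ | _ = left∈star⁺ (inj₂ (edgeˡ⁻ xw))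
    ...   | _ | inj₁ refl | _ = left∈star⁺ (inj₂ (flip (edgeˡ⁻ wy)))
    ...   | _ | _ | yes c≡u = left∈star⁺ (inj₁ c≡u)
    ...   | inj₂ ux | inj₂ uy | no c≢u =
      ⊥-elim (no-square (λ u≡c → c≢u (sym u≡c)) x≢y ux (edgeˡ⁻ xw) (edgeˡ⁻ wy) (flip uy))

    star-midpoints : MidpointClosed H star
    star-midpoints {i} {j} i∈ j∈ i≢j i≁j iw wj with copy i | copy j
    ... | inLeft x | inLeft y = leftMidpoint (left∈star⁻ i∈) (left∈star⁻ j∈) (λ x≡y → i≢j (cong left x≡y)) iw wj
    ... | inLeft x | inRight y = crossMidpoint (left∈star⁻ i∈) (right∈star⁻ j∈) iw wj
    ... | inRight x | inLeft y = crossMidpoint (left∈star⁻ j∈) (right∈star⁻ i∈) (H-flip wj) (H-flip iw)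
    ... | inRight x | inRight y =
      contradiction (edgeʳ⁺ (neighbours-nonadjacent (right∈star⁻ i∈) (right∈star⁻ j∈)) (λ x≡y → i≢j (cong right x≡y))) i≁j

    starWitness : ConvexWitness H (2 * degree G u + 1)
    starWitness =
      star , (right u , λ u∈ → irreflexive u (right∈star⁻ u∈)) ,
      midpointClosed⇒convex H star star-near star-midpoints ,
      trans (∣++∣ N[ u ] (N u)) (trans (cong (_+ degree G u) (∣N[]∣ (irreflexive u))) (starSize (degree G u)))

module UpperBound {n : ℕ} (G : Graph n) (tree : IsTree G) (path : Tree.LongPath G tree)
                  (A B : Subset n) (convex : Convex (prism G) (A ++ B)) where
  open Tree G tree
  open LongPath path
  open Prism G
  open Neighbourhood G

  S : Subset (n + n)
  S = A ++ B

  midpoint : MidpointClosed H S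
  midpoint = convex⇒midpointClosed H S convex

  -- Four geodesics of length two and the memberships they force.
  -- First, x w y inside the left copy.
  A-midpoints : ∀ {x y w} → x ∈ A → y ∈ A → x ≢ y → ¬ T (G x y) → T (G x w) → T (G w y) → w ∈ A
  A-midpoints x∈A y∈A x≢y x≁y xw wy =
    ∈-++⁻ˡ A B (midpoint (∈-++⁺ˡ B x∈A) (∈-++⁺ˡ B y∈A) (λ eq → x≢y (left-injective eq))
                         (λ t → x≁y (edgeˡ⁻ t)) (edgeˡ⁺ xw) (edgeˡ⁺ wy))

  -- a v v̄, for an edge av
  A-absorbs-B-neighbour : ∀ {a v} → a ∈ A → v ∈ B → T (G a v) → v ∈ A
  A-absorbs-B-neighbour {a} {v} a∈A v∈B av =
    ∈-++⁻ˡ A B (midpoint (∈-++⁺ˡ B a∈A) (∈-++⁺ʳ A v∈B) left≢right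
                         (λ t → adjacent⇒≢ av (rungˡ⁻ t)) (edgeˡ⁺ av) (rung v))

  -- a ā v̄, for distinct non-adjacent a, v
  A-in-B-unless-adjacent : ∀ {a v} → a ∈ A → v ∈ B → a ≢ v → ¬ T (G a v) → a ∈ B
  A-in-B-unless-adjacent {a} {v} a∈A v∈B a≢v a≁v =
    ∈-++⁻ʳ A B (midpoint (∈-++⁺ˡ B a∈A) (∈-++⁺ʳ A v∈B) left≢right
                         (λ t → a≢v (rungˡ⁻ t)) (rung a) (edgeʳ⁺ a≁v a≢v))

  -- ū w̄ v̄, for an edge uv and a vertex w far from it
  B-absorbs-far : ∀ {u v w} → u ∈ B → v ∈ B → T (G u v) → ¬ Close u v w → w ∈ B
  B-absorbs-far {u} {v} u∈B v∈B uv far-w with far⇒complementMidpoint far-w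
  ... | uw , wv =
    ∈-++⁻ʳ A B (midpoint (∈-++⁺ʳ A u∈B) (∈-++⁺ʳ A v∈B) (λ eq → adjacent⇒≢ uv (right-injective eq))
                         (λ t → edgeʳ⁻ t uv) uw wv)

  A∖B-dominates-B : ∀ {a v} → a ∈ A → a ∉ B → v ∈ B → T (G a v)
  A∖B-dominates-B {a} {v} a∈A a∉B v∈B with T? (G a v) | a ≟ᶠ v
  ... | yes av | _ = av
  ... | no _ | yes refl = contradiction v∈B a∉B
  ... | no a≁v | no a≢v = contradiction (A-in-B-unless-adjacent a∈A v∈B a≢v a≁v) a∉B

  starBound : ∀ c → A ⊆ N[ c ] → ∣ B ∣ ≤ degree G c → ∣ A ∣ + ∣ B ∣ ≤ 2 * maxDegree G + 1
  starBound c A⊆N[c] ∣B∣≤deg =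
    ≤-trans (+-mono-≤ (subst (∣ A ∣ ≤_) (∣N[]∣ (irreflexive c)) (p⊆q⇒∣p∣≤∣q∣ A⊆N[c])) ∣B∣≤deg)
            (starSize-mono (degree≤maxDegree c))

  -- Case A ⊈ B: B ⊆ N(a₀) for some a₀ ∈ A ∖ B.  If B has two distinct
  -- vertices b, b′, then A ⊆ N[a₀] (a vertex of A ∖ B other than a₀ would
  -- close the 4-cycle a₀ b w b′); if B = {b}, then A ⊆ N[b] and 1 ≤ deg b.
  module Outsider {a₀} (a₀∈A : a₀ ∈ A) (a₀∉B : a₀ ∉ B) where

    B⊆N[a₀] : B ⊆ N a₀
    B⊆N[a₀] v∈B = ∈N⁺ (A∖B-dominates-B a₀∈A a₀∉B v∈B)

    twoInB : ∀ {b b′} → b ∈ B → b′ ∈ B → b′ ≢ b → A ⊆ N[ a₀ ]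
    twoInB {b} {b′} b∈B b′∈B b′≢b {w} w∈A with w ≟ᶠ a₀ | w ∈? B
    ... | yes w≡a₀ | _ = ∈N[]⁺ (inj₁ w≡a₀)
    ... | no _ | yes w∈B = ∈N[]⁺ (inj₂ (A∖B-dominates-B a₀∈A a₀∉B w∈B))
    ... | no w≢a₀ | no w∉B =
      ⊥-elim (no-square (λ a₀≡w → w≢a₀ (sym a₀≡w)) (λ b≡b′ → b′≢b (sym b≡b′))
                        (A∖B-dominates-B a₀∈A a₀∉B b∈B) (flip (A∖B-dominates-B w∈A w∉B b∈B))
                        (A∖B-dominates-B w∈A w∉B b′∈B) (flip (A∖B-dominates-B a₀∈A a₀∉B b′∈B)))

    oneInB : ∀ {b} → b ∈ B → B ⊆ ⁅ b ⁆ → A ⊆ N[ b ]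
    oneInB {b} b∈B B⊆⁅b⁆ {w} w∈A with w ≟ᶠ b | w ∈? B
    ... | yes w≡b | _ = ∈N[]⁺ (inj₁ w≡b)
    ... | no w≢b | yes w∈B = contradiction (x∈⁅y⁆⇒x≡y b (B⊆⁅b⁆ w∈B)) w≢b
    ... | no _ | no w∉B = ∈N[]⁺ (inj₂ (flip (A∖B-dominates-B w∈A w∉B b∈B)))

    outsiderBound : ∣ A ∣ + ∣ B ∣ ≤ n ⊔ (2 * maxDegree G + 1)
    outsiderBound with nonempty? B
    ... | no empty = ≤-trans (+-mono-≤ (∣p∣≤n A) (≤-reflexive ∣B∣≡0)) (≤-trans (≤-reflexive (+-identityʳ n)) (m≤m⊔n n _))
      where
      ∣B∣≡0 : ∣ B ∣ ≡ 0
      ∣B∣≡0 = trans (cong ∣_∣ (Empty-unique empty)) (∣⊥∣≡0 n)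
    ... | yes (b , b∈B) with any? (λ b′ → (b′ ∈? B) ×-dec ¬? (b′ ≟ᶠ b))
    ...   | yes (b′ , b′∈B , b′≢b) =
      ≤-trans (starBound a₀ (twoInB b∈B b′∈B b′≢b) (p⊆q⇒∣p∣≤∣q∣ B⊆N[a₀])) (m≤n⊔m n _)
    ...   | no single = ≤-trans (starBound b (oneInB b∈B B⊆⁅b⁆) ∣B∣≤deg) (m≤n⊔m n _)
      where
      B⊆⁅b⁆ : B ⊆ ⁅ b ⁆
      B⊆⁅b⁆ {v} v∈B with v ≟ᶠ b
      ... | yes refl = x∈⁅x⁆ b
      ... | no v≢b = contradiction (v , v∈B , v≢b) single
      ⁅a₀⁆⊆N[b] : ⁅ a₀ ⁆ ⊆ N b
      ⁅a₀⁆⊆N[b] x∈ = subst (_∈ N b) (sym (x∈⁅y⁆⇒x≡y a₀ x∈)) (∈N⁺ (flip (A∖B-dominates-B a₀∈A a₀∉B b∈B)))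
      ∣B∣≤deg : ∣ B ∣ ≤ degree G b
      ∣B∣≤deg = begin
        ∣ B ∣        ≤⟨ p⊆q⇒∣p∣≤∣q∣ B⊆⁅b⁆ ⟩
        ∣ ⁅ b ⁆ ∣    ≡⟨ ∣⁅x⁆∣≡1 b ⟩
        1            ≡⟨ sym (∣⁅x⁆∣≡1 a₀) ⟩
        ∣ ⁅ a₀ ⁆ ∣   ≤⟨ p⊆q⇒∣p∣≤∣q∣ ⁅a₀⁆⊆N[b] ⟩
        degree G b   ∎
        where open ≤-Reasoning

  -- Towards the case A ⊆ B: if some vertex b is adjacent to every vertex
  -- outside B, then B = V, for otherwise the ends of the long path would be at
  -- distance ≤ 4 through V ∖ B and b.

  outside-B-near : ∀ {p q y} → p ∈ B → q ∈ B → T (G p q) → y ∉ B → Within G 2 y q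
  outside-B-near {p} {q} {y} p∈B q∈B pq y∉B with close? p q y
  ... | yes close = close⇒within2 pq close
  ... | no notClose = contradiction (B-absorbs-far p∈B q∈B pq notClose) y∉B

  NearStart NearEnd : Set
  NearStart = (∀ {z} → z ∉ B → Within G 2 start z) ⊎ (∃ λ z → z ∉ B × Within G 1 start z)
  NearEnd = (∀ {z} → z ∉ B → Within G 2 z end) ⊎ (∃ λ z → z ∉ B × Within G 1 z end)

  startSide : NearStart
  startSide with start ∈? B | next ∈? B
  ... | no start∉B | _ = inj₂ (start , start∉B , within-weaken z≤n within-refl)
  ... | yes _ | no next∉B = inj₂ (next , next∉B , within-edge start-edge)
  ... | yes start∈B | yes next∈B =
    inj₁ λ z∉B → within-sym symmetric (outside-B-near next∈B start∈B (flip start-edge) z∉B)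

  endSide : NearEnd
  endSide with prev ∈? B | end ∈? B
  ... | _ | no end∉B = inj₂ (end , end∉B , within-weaken z≤n within-refl)
  ... | no prev∉B | yes _ = inj₂ (prev , prev∉B , within-edge end-edge)
  ... | yes prev∈B | yes end∈B = inj₁ λ z∉B → outside-B-near prev∈B end∈B end-edge z∉B

  dominated⇒B-full : ∀ {b} → (∀ {y} → y ∉ B → T (G b y)) → ∀ y → y ∈ B
  dominated⇒B-full {b} dominates y with y ∈? B
  ... | yes y∈B = y∈B
  ... | no y∉B = ⊥-elim (far (throughOutside startSide endSide))
    where
    throughOutside : NearStart → NearEnd → Within G 4 start end
    throughOutside (inj₁ start-near) (inj₁ end-near) = within-trans (start-near y∉B) (end-near y∉B)
    throughOutside (inj₁ start-near) (inj₂ (z , z∉B , z-end)) =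
      within-weaken (s≤s (s≤s (s≤s z≤n))) (within-trans (start-near z∉B) z-end)
    throughOutside (inj₂ (z , z∉B , start-z)) (inj₁ end-near) =
      within-weaken (s≤s (s≤s (s≤s z≤n))) (within-trans start-z (end-near z∉B))
    throughOutside (inj₂ (z , z∉B , start-z)) (inj₂ (z′ , z′∉B , z′-end)) =
      within-trans start-z (within-trans (within-edge (flip (dominates z∉B)))
                                         (within-trans (within-edge (dominates z′∉B)) z′-end))

  A-spreads : (∀ y → y ∈ B) → ∀ {a y k} → a ∈ A → Walk G a y k → y ∈ A
  A-spreads B-full a∈A here = a∈A
  A-spreads B-full a∈A (step e p) = A-spreads B-full (A-absorbs-B-neighbour a∈A (B-full _) e) p

  B-full⇒improper : (∀ y → y ∈ B) → ∀ {a} → a ∈ A → ¬ Proper S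
  B-full⇒improper B-full {a} a∈A (i , i∉S) with copy i
  ... | inLeft x = i∉S (∈-++⁺ˡ B (A-spreads B-full a∈A (proj₂ (connected a x))))
  ... | inRight y = i∉S (∈-++⁺ʳ A (B-full y))

  -- Hence, when A ⊆ B, every a ∈ A has an "exit": a neighbour outside B.
  -- Exits are distinct, since two vertices of A sharing an exit x would span
  -- a triangle with x or have x as a midpoint (putting x into A ⊆ B);
  -- so |A| ≤ |V ∖ B|.
  module Nested (A⊆B : A ⊆ B) (proper : Proper S) where

    -- if all neighbours of a ∈ A lay in B, a neighbour b of a would be adjacent
    -- to every vertex outside B (which lies outside N[a] ∪ N[b] otherwise)
    exits-exist : ∀ {a} → a ∈ A → ¬ (∀ {x} → T (G a x) → x ∈ B)
    exits-exist {a} a∈A trapped with neighbour path a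
    ... | b , ab = B-full⇒improper (dominated⇒B-full dominates) a∈A proper
      where
      dominates : ∀ {y} → y ∉ B → T (G b y)
      dominates {y} y∉B with T? (G b y)
      ... | yes by = by
      ... | no b≁y = contradiction (B-absorbs-far (A⊆B a∈A) (trapped ab) ab notClose) y∉B
        where
        notClose : ¬ Close a b y
        notClose (inj₁ refl) = y∉B (A⊆B a∈A)
        notClose (inj₂ (inj₁ refl)) = y∉B (trapped ab)
        notClose (inj₂ (inj₂ (inj₁ ay))) = y∉B (trapped ay)
        notClose (inj₂ (inj₂ (inj₂ by))) = b≁y by

    exit : Fin n → Fin n
    exit a with any? (λ x → T? (G a x) ×-dec ¬? (x ∈? B))
    ... | yes (x , _) = x
    ... | no _ = a

    exit-spec : ∀ {a} → a ∈ A → T (G a (exit a)) × exit a ∉ B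
    exit-spec {a} a∈A with any? (λ x → T? (G a x) ×-dec ¬? (x ∈? B))
    ... | yes (_ , spec) = spec
    ... | no none = ⊥-elim (exits-exist a∈A λ {x} ax → decidable-stable (x ∈? B) (λ x∉B → none (x , ax , x∉B)))

    exit-injective : ∀ {a a′} → a ∈ A → a′ ∈ A → exit a ≡ exit a′ → a ≡ a′
    exit-injective {a} {a′} a∈A a′∈A same =
      sharedExit (exit-spec a∈A) (subst (λ x → T (G a′ x)) (sym same) (proj₁ (exit-spec a′∈A)))
      where
      sharedExit : T (G a (exit a)) × exit a ∉ B → T (G a′ (exit a)) → a ≡ a′
      sharedExit (ax , x∉B) a′x with a ≟ᶠ a′ | T? (G a a′)
      ... | yes a≡a′ | _ = a≡a′
      ... | no _ | yes aa′ = ⊥-elim (no-triangle aa′ a′x (flip ax))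
      ... | no a≢a′ | no a≁a′ = contradiction (A⊆B (A-midpoints a∈A a′∈A a≢a′ a≁a′ ax (flip a′x))) x∉B

    nestedBound : ∣ A ∣ + ∣ B ∣ ≤ n
    nestedBound = m≤o∸n⇒m+n≤o ∣ A ∣ (∣p∣≤n B) (subst (∣ A ∣ ≤_) (∣∁p∣≡n∸∣p∣ B) ∣A∣≤∣∁B∣)
      where
      ∣A∣≤∣∁B∣ : ∣ A ∣ ≤ ∣ ∁ B ∣
      ∣A∣≤∣∁B∣ = injection⇒∣p∣≤∣q∣ ∣ A ∣ A (∁ B) exit refl
                   (λ a∈A → x∉p⇒x∈∁p (proj₂ (exit-spec a∈A))) exit-injective

  bound : Proper S → ∣ A ∣ + ∣ B ∣ ≤ n ⊔ (2 * maxDegree G + 1)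
  bound proper with any? (λ a → (a ∈? A) ×-dec ¬? (a ∈? B))
  ... | yes (a₀ , a₀∈A , a₀∉B) = Outsider.outsiderBound a₀∈A a₀∉B
  ... | no none = ≤-trans (Nested.nestedBound A⊆B proper) (m≤m⊔n n _)
    where
    A⊆B : A ⊆ B
    A⊆B {a} a∈A = decidable-stable (a ∈? B) (λ a∉B → none (a , a∈A , a∉B))

theorem3p7 : ∀ (n : ℕ) (T : Graph n) → IsTree T → DiamAtLeast T 5 →
    IsConvexityNumber (prism T) (n ⊔ (2 * maxDegree T + 1))
theorem3p7 n G tree diam≥5 = lower , upper
  where
  path = Tree.longPath G tree diam≥5
  M = 2 * maxDegree G + 1

  lower : ConvexWitness (prism G) (n ⊔ M)
  lower with ⊔-sel n M
  ... | inj₁ max≡n = subst (ConvexWitness (prism G)) (sym max≡n) (LowerBound.RightCopy.rightCopyWitness G tree path)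
  ... | inj₂ max≡M with Neighbourhood.maxDegree-attained G (Tree.LongPath.start path)
  ...   | c , deg≡Δ = subst (ConvexWitness (prism G)) (trans (cong (λ d → 2 * d + 1) deg≡Δ) (sym max≡M))
                            (LowerBound.Star.starWitness G tree c)

  upper : ∀ S → Proper S → Convex (prism G) S → ∣ S ∣ ≤ n ⊔ M
  upper S proper convex with splitAtᵛ n S
  ... | A , B , refl = subst (_≤ n ⊔ M) (sym (∣++∣ A B)) (UpperBound.bound G tree path A B convex proper)
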